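{- For $n\ge 4$, $m_4^3(n,2)=n-1$. For any integers $r\ge 3$, $k\ge r-1$, $t\ge r+1$ with $(r,t,k)\ne(3,4,2)$, and any $n$, if $s\in\{0,1,\dots,k-1\}$ satisfies $n\equiv s\pmod k$, then $m_t^r(n,k)\ge \lfloor n/k\rfloor^{k-s}\lceil n/k\rceil^{s}$.
   Context: In an $r$-uniform hypergraph, an independent set is a vertex set containing no hyperedge, and a maximal independent set (MIS) is one maximal under inclusion. $K_t^r$ denotes the complete $r$-uniform hypergraph on $t$ vertices. $m_t^r(n,k)$ is the maximum number of MIS's of size $k$ in a $K_t^r$-free $r$-uniform hypergraph on $n$ vertices. -}

module Defs where

open import Data.Nat using (ℕ; _≤_; _+_; _∸_; _/_; NonZero)
open import Data.Bool using (Bool; T)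
open import Data.Fin.Subset using (Subset; _⊆_; ∣_∣)
open import Data.List using (List; length)
open import Data.List.Relation.Unary.All using (All)
open import Data.List.Relation.Unary.Unique.Propositional using (Unique)
open import Data.Product using (Σ; _×_; ∃)
open import Relation.Nullary using (¬_)
open import Relation.Binary.PropositionalEquality using (_≡_)

record Hypergraph (n : ℕ) : Set where
  field
    edge : Subset n → Bool

open Hypergraph public

IsEdge : ∀ {n} → Hypergraph n → Subset n → Set
IsEdge H S = T (edge H S)

Uniform : ∀ {n} → ℕ → Hypergraph n → Set
Uniform r H = ∀ S → IsEdge H S → ∣ S ∣ ≡ r

-- H contains a copy of K_t^r: a t-set all of whose r-subsets are edges
-- (in an r-uniform hypergraph on a vertex set, a copy of K_t^r is exactly this)
ContainsK : ∀ {n} → ℕ → ℕ → Hypergraph n → Set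
ContainsK r t H = Σ (Subset _) λ U → ∣ U ∣ ≡ t × (∀ S → S ⊆ U → ∣ S ∣ ≡ r → IsEdge H S)

KFree : ∀ {n} → ℕ → ℕ → Hypergraph n → Set
KFree r t H = ¬ ContainsK r t H

Independent : ∀ {n} → Hypergraph n → Subset n → Set
Independent H I = ∀ S → S ⊆ I → ¬ IsEdge H S

IsMIS : ∀ {n} → Hypergraph n → Subset n → Set
IsMIS H I = Independent H I × (∀ J → I ⊆ J → Independent H J → J ≡ I)

IsMISOfSize : ∀ {n} → Hypergraph n → ℕ → Subset n → Set
IsMISOfSize H k I = IsMIS H I × ∣ I ∣ ≡ k

AtLeastMIS : ∀ {n} → Hypergraph n → ℕ → ℕ → Set
AtLeastMIS H k N =
  Σ (List (Subset _)) λ L → Unique L × All (IsMISOfSize H k) L × length L ≡ N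

AtMostMIS : ∀ {n} → Hypergraph n → ℕ → ℕ → Set
AtMostMIS H k N =
  ∀ (L : List (Subset _)) → Unique L → All (IsMISOfSize H k) L → length L ≤ N

mGe : (r t n k N : ℕ) → Set
mGe r t n k N = Σ (Hypergraph n) λ H → Uniform r H × KFree r t H × AtLeastMIS H k N

mLe : (r t n k N : ℕ) → Set
mLe r t n k N = ∀ (H : Hypergraph n) → Uniform r H → KFree r t H → AtMostMIS H k N

mEq : (r t n k N : ℕ) → Set
mEq r t n k N = mGe r t n k N × mLe r t n k N

⌈_/_⌉ : (n k : ℕ) .{{_ : NonZero k}} → ℕ
⌈ n / k ⌉ = (n + (k ∸ 1)) / k

-- Part 1. In a K₄³-free 3-graph any two MIS's of size 2 meet: otherwise their
-- union is a 4-set each of whose triples contains one of them, and a triple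
-- containing a maximal independent pair is an edge. If they do not all share a
-- vertex, three of them form a triangle ab, be, ae, which with any fourth vertex
-- spans a K₄³. So they form a star, with at most n − 1 pairs; all triples
-- through one fixed vertex give a hypergraph attaining this.
--
-- Part 2. Split the vertices into their residue classes mod k, of sizes ⌊n/k⌋
-- and ⌈n/k⌉, and take as edges the r-sets with two vertices in some class i,
-- at least one in class i + 1 (mod k) and at most one in every other class.
-- Every transversal of the classes is a maximal independent set of size k.
-- A copy of K_t^r has at most two vertices per class; two classes with two
-- vertices each are impossible for r ≥ 4, and for r = 3 each must follow the
-- other cyclically, forcing k = 2 and t = 4. Otherwise dropping one vertex of
-- the doubled class leaves at least r vertices in distinct classes, and these
-- contain no edge.

module Submission where

open import Defs
open import Data.Nat using (ℕ; zero; suc; _+_; _*_; _∸_; _^_; _≤_; _<_; _≥_; z≤n; s≤s; _≤?_; _<?_; _≟_; NonZero; _%_; _/_)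
open import Data.Nat.Properties
open import Data.Nat.DivMod using (m≡m%n+[m/n]*n; m%n<n; m<n⇒m%n≡m; %-congˡ; n%n≡0; [m+kn]%n≡m%n; /-congˡ; +-distrib-/-∣ʳ; m<n⇒m/n≡0; m*n/n≡m)
open import Data.Nat.Divisibility using (n∣m*n)
open import Data.Nat.Solver using (module +-*-Solver)
open import Data.Bool using (true; false; if_then_else_)
open import Data.Bool.Properties using (T?)
open import Data.Empty using (⊥; ⊥-elim)
open import Data.Fin using (Fin; zero; suc; toℕ; fromℕ<)
import Data.Fin.Properties as Fin
open import Data.Fin.Subset renaming (⊥ to ∅)
open import Data.Fin.Subset.Properties
open import Data.Vec using (Vec; []; _∷_; here; there; tabulate; lookup)
open import Data.Vec.Properties using (∷-injective; lookup∘tabulate; tabulate∘lookup; tabulate-cong; []=⇒lookup; lookup⇒[]=)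
open import Data.List using (List; []; _∷_; map; length; allFin; upTo; cartesianProductWith)
open import Data.List.Properties using (length-map; length-tabulate; length-upTo; length-++)
open import Data.List.Relation.Unary.All using (All; []; _∷_; all?)
import Data.List.Relation.Unary.All as All
open import Data.List.Relation.Unary.All.Properties using (All¬⇒¬Any; ¬All⇒Any¬; tabulate⁺) renaming (map⁺ to All-map⁺)
import Data.List.Relation.Unary.Any as Any
open import Data.List.Relation.Unary.Unique.Propositional using (Unique; []; _∷_)
open import Data.List.Relation.Unary.Unique.Propositional.Properties using (upTo⁺; allFin⁺; cartesianProductWith⁺) renaming (map⁺ to Unique-map⁺)
open import Data.List.Membership.Propositional using (find) renaming (_∈_ to _∈ₗ_)
open import Data.List.Membership.Propositional.Properties using (∈-map⁺; ∈-map⁻; ∈-allFin; ∈-upTo⁻; ∈-cartesianProductWith⁻)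
open import Data.Product using (∃; ∃₂; _×_; _,_; proj₁; proj₂)
open import Data.Sum using (_⊎_; inj₁; inj₂; [_,_]′)
import Data.Sum as Sum
open import Function using (_∘_)
open import Relation.Nullary using (¬_; Dec; yes; no; does; contradiction; ¬?)
open import Relation.Nullary.Decidable using (⌊_⌋; toWitness; fromWitness; dec-true; _×-dec_; _→-dec_)
open import Relation.Unary using (Decidable)
open import Relation.Binary.PropositionalEquality

private variable
  n m : ℕ
  x y : Fin n

-- Finite subsets

∪-lub : ∀ {p q r : Subset n} → p ⊆ r → q ⊆ r → p ∪ q ⊆ r
∪-lub {p = p} {q = q} p⊆r q⊆r x∈p∪q with x∈p∪q⁻ p q x∈p∪q
... | inj₁ x∈p = p⊆r x∈p
... | inj₂ x∈q = q⊆r x∈q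

⁅x⁆⊆p : ∀ {p : Subset n} → x ∈ p → ⁅ x ⁆ ⊆ p
⁅x⁆⊆p {x = x} x∈p y∈⁅x⁆ = subst (_∈ _) (sym (x∈⁅y⁆⇒x≡y x y∈⁅x⁆)) x∈p

x∈p─q⇒x∉q : ∀ (p q : Subset n) → x ∈ p ─ q → x ∉ q
x∈p─q⇒x∉q (true ∷ p) (false ∷ q) here ()
x∈p─q⇒x∉q (_ ∷ p) (_ ∷ q) (there x∈p─q) (there x∈q) = x∈p─q⇒x∉q p q x∈p─q x∈q

x∈p-y⇒x≢y : ∀ (p : Subset n) → x ∈ p - y → x ≢ y
x∈p-y⇒x≢y {y = y} p x∈p-y refl = x∈p─q⇒x∉q p ⁅ y ⁆ x∈p-y (x∈⁅x⁆ y)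

∣p∣+∣q∣≡∣p∪q∣+∣p∩q∣ : ∀ (p q : Subset n) → ∣ p ∣ + ∣ q ∣ ≡ ∣ p ∪ q ∣ + ∣ p ∩ q ∣
∣p∣+∣q∣≡∣p∪q∣+∣p∩q∣ [] [] = refl
∣p∣+∣q∣≡∣p∪q∣+∣p∩q∣ (true ∷ p) (true ∷ q) =
  cong suc (trans (+-suc ∣ p ∣ ∣ q ∣) (trans (cong suc (∣p∣+∣q∣≡∣p∪q∣+∣p∩q∣ p q)) (sym (+-suc _ _))))
∣p∣+∣q∣≡∣p∪q∣+∣p∩q∣ (true ∷ p) (false ∷ q) = cong suc (∣p∣+∣q∣≡∣p∪q∣+∣p∩q∣ p q)
∣p∣+∣q∣≡∣p∪q∣+∣p∩q∣ (false ∷ p) (true ∷ q) =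
  trans (+-suc ∣ p ∣ ∣ q ∣) (cong suc (∣p∣+∣q∣≡∣p∪q∣+∣p∩q∣ p q))
∣p∣+∣q∣≡∣p∪q∣+∣p∩q∣ (false ∷ p) (false ∷ q) = ∣p∣+∣q∣≡∣p∪q∣+∣p∩q∣ p q

∣p∪q∣≤∣p∣+∣q∣ : ∀ (p q : Subset n) → ∣ p ∪ q ∣ ≤ ∣ p ∣ + ∣ q ∣
∣p∪q∣≤∣p∣+∣q∣ p q = subst (∣ p ∪ q ∣ ≤_) (sym (∣p∣+∣q∣≡∣p∪q∣+∣p∩q∣ p q)) (m≤m+n _ _)

disjoint⇒∣p∪q∣≡∣p∣+∣q∣ : ∀ (p q : Subset n) → (∀ {x} → x ∈ p → x ∉ q) →
                         ∣ p ∪ q ∣ ≡ ∣ p ∣ + ∣ q ∣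
disjoint⇒∣p∪q∣≡∣p∣+∣q∣ {n} p q disjoint = begin
  ∣ p ∪ q ∣             ≡⟨ sym (+-identityʳ _) ⟩
  ∣ p ∪ q ∣ + 0         ≡⟨ cong (∣ p ∪ q ∣ +_) (sym ∣p∩q∣≡0) ⟩
  ∣ p ∪ q ∣ + ∣ p ∩ q ∣ ≡⟨ sym (∣p∣+∣q∣≡∣p∪q∣+∣p∩q∣ p q) ⟩
  ∣ p ∣ + ∣ q ∣         ∎
  where
  open ≡-Reasoning
  p∩q-empty : Empty (p ∩ q)
  p∩q-empty (x , x∈p∩q) = let x∈p , x∈q = x∈p∩q⁻ p q x∈p∩q in disjoint x∈p x∈q
  ∣p∩q∣≡0 : ∣ p ∩ q ∣ ≡ 0
  ∣p∩q∣≡0 = trans (cong ∣_∣ (Empty-unique p∩q-empty)) (∣⊥∣≡0 n)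

∃∈∉? : ∀ (p q : Subset n) → Dec (∃ λ x → x ∈ p × x ∉ q)
∃∈∉? p q = Fin.any? λ x → (x ∈? p) ×-dec ¬? (x ∈? q)

¬∃∈∉⇒⊆ : ∀ {p q : Subset n} → ¬ (∃ λ x → x ∈ p × x ∉ q) → p ⊆ q
¬∃∈∉⇒⊆ {q = q} none {x} x∈p with x ∈? q
... | yes x∈q = x∈q
... | no x∉q = contradiction (x , x∈p , x∉q) none

∣q∣<∣p∣⇒∃∈∉ : ∀ (p q : Subset n) → ∣ q ∣ < ∣ p ∣ → ∃ λ x → x ∈ p × x ∉ q
∣q∣<∣p∣⇒∃∈∉ p q ∣q∣<∣p∣ with ∃∈∉? p q
... | yes witness = witness
... | no none = contradiction (p⊆q⇒∣p∣≤∣q∣ (¬∃∈∉⇒⊆ none)) (<⇒≱ ∣q∣<∣p∣)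

⊆∧∣p∣≡∣q∣⇒p≡q : ∀ {p q : Subset n} → p ⊆ q → ∣ p ∣ ≡ ∣ q ∣ → p ≡ q
⊆∧∣p∣≡∣q∣⇒p≡q {p = p} {q = q} p⊆q ∣p∣≡∣q∣ with ∃∈∉? q p
... | yes witness = contradiction ∣p∣≡∣q∣ (<⇒≢ (p⊂q⇒∣p∣<∣q∣ (p⊆q , witness)))
... | no none = ⊆-antisym p⊆q (¬∃∈∉⇒⊆ none)

0<∣p∣⇒Nonempty : ∀ (p : Subset n) → 0 < ∣ p ∣ → Nonempty p
0<∣p∣⇒Nonempty {n} p 0<∣p∣ =
  let x , x∈p , _ = ∣q∣<∣p∣⇒∃∈∉ p ∅ (subst (_< ∣ p ∣) (sym (∣⊥∣≡0 n)) 0<∣p∣) in x , x∈p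

x∈p⇒0<∣p∣ : ∀ {p : Subset n} → x ∈ p → 0 < ∣ p ∣
x∈p⇒0<∣p∣ {x = x} x∈p = subst (_≤ _) (∣⁅x⁆∣≡1 x) (p⊆q⇒∣p∣≤∣q∣ (⁅x⁆⊆p x∈p))

x∉p⇒∣p∪⁅x⁆∣≡1+∣p∣ : ∀ (p : Subset n) → x ∉ p → ∣ p ∪ ⁅ x ⁆ ∣ ≡ suc ∣ p ∣
x∉p⇒∣p∪⁅x⁆∣≡1+∣p∣ {x = x} p x∉p = begin
  ∣ p ∪ ⁅ x ⁆ ∣     ≡⟨ disjoint⇒∣p∪q∣≡∣p∣+∣q∣ p ⁅ x ⁆ (λ y∈p y∈⁅x⁆ → x∉p (subst (_∈ p) (x∈⁅y⁆⇒x≡y x y∈⁅x⁆) y∈p)) ⟩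
  ∣ p ∣ + ∣ ⁅ x ⁆ ∣ ≡⟨ cong (∣ p ∣ +_) (∣⁅x⁆∣≡1 x) ⟩
  ∣ p ∣ + 1         ≡⟨ +-comm ∣ p ∣ 1 ⟩
  suc ∣ p ∣         ∎
  where open ≡-Reasoning

p⊆p-x∪⁅x⁆ : ∀ (p : Subset n) x → p ⊆ (p - x) ∪ ⁅ x ⁆
p⊆p-x∪⁅x⁆ p x {y} y∈p with y Fin.≟ x
... | yes refl = x∈p∪q⁺ (inj₂ (x∈⁅x⁆ x))
... | no y≢x = x∈p∪q⁺ (inj₁ (x∈p∧x≢y⇒x∈p-y y∈p y≢x))

∣p∣≤1+∣p-x∣ : ∀ (p : Subset n) x → ∣ p ∣ ≤ suc ∣ p - x ∣
∣p∣≤1+∣p-x∣ p x = begin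
  ∣ p ∣                   ≤⟨ p⊆q⇒∣p∣≤∣q∣ (p⊆p-x∪⁅x⁆ p x) ⟩
  ∣ (p - x) ∪ ⁅ x ⁆ ∣     ≤⟨ ∣p∪q∣≤∣p∣+∣q∣ (p - x) ⁅ x ⁆ ⟩
  ∣ p - x ∣ + ∣ ⁅ x ⁆ ∣   ≡⟨ cong (∣ p - x ∣ +_) (∣⁅x⁆∣≡1 x) ⟩
  ∣ p - x ∣ + 1           ≡⟨ +-comm ∣ p - x ∣ 1 ⟩
  suc ∣ p - x ∣           ∎
  where open ≤-Reasoning

x∈p⇒∣p∣≡1+∣p-x∣ : ∀ (p : Subset n) → x ∈ p → ∣ p ∣ ≡ suc ∣ p - x ∣
x∈p⇒∣p∣≡1+∣p-x∣ {x = x} p x∈p = ≤-antisym (∣p∣≤1+∣p-x∣ p x) (x∈p⇒∣p-x∣<∣p∣ x∈p)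

p⊆q∧x∉p⇒p⊆q-x : ∀ {p q : Subset n} {x} → p ⊆ q → x ∉ p → p ⊆ q - x
p⊆q∧x∉p⇒p⊆q-x p⊆q x∉p y∈p = x∈p∧x≢y⇒x∈p-y (p⊆q y∈p) (λ y≡x → x∉p (subst (_∈ _) y≡x y∈p))

⊆-interpolate : ∀ {a u : Subset n} m → a ⊆ u → ∣ a ∣ ≤ m → m ≤ ∣ u ∣ →
                ∃ λ s → a ⊆ s × s ⊆ u × ∣ s ∣ ≡ m
⊆-interpolate {a = []} {[]} zero _ _ _ = [] , (λ ()) , (λ ()) , refl
⊆-interpolate {a = true ∷ a} {true ∷ u} (suc m) a⊆u (s≤s ∣a∣≤m) (s≤s m≤∣u∣)
  with s , a⊆s , s⊆u , ∣s∣≡m ← ⊆-interpolate m (drop-∷-⊆ a⊆u) ∣a∣≤m m≤∣u∣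
  = true ∷ s , s⊆s a⊆s , s⊆s s⊆u , cong suc ∣s∣≡m
⊆-interpolate {a = true ∷ a} {false ∷ u} m a⊆u _ _ with () ← a⊆u here
⊆-interpolate {a = false ∷ a} {false ∷ u} m a⊆u ∣a∣≤m m≤∣u∣
  with s , a⊆s , s⊆u , ∣s∣≡m ← ⊆-interpolate m (drop-∷-⊆ a⊆u) ∣a∣≤m m≤∣u∣
  = false ∷ s , s⊆s a⊆s , s⊆s s⊆u , ∣s∣≡m
⊆-interpolate {a = false ∷ a} {true ∷ u} m a⊆u ∣a∣≤m m≤1+∣u∣ with m ≤? ∣ u ∣
... | yes m≤∣u∣ with s , a⊆s , s⊆u , ∣s∣≡m ← ⊆-interpolate m (drop-∷-⊆ a⊆u) ∣a∣≤m m≤∣u∣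
  = false ∷ s , s⊆s a⊆s , out⊆ s⊆u , ∣s∣≡m
... | no m≰∣u∣ = true ∷ u , out⊆ (drop-∷-⊆ a⊆u) , ⊆-refl , ≤-antisym (≰⇒> m≰∣u∣) m≤1+∣u∣

∃-subset-of-size : ∀ (u : Subset n) m → m ≤ ∣ u ∣ → ∃ λ s → s ⊆ u × ∣ s ∣ ≡ m
∃-subset-of-size {n} u m m≤∣u∣ =
  let s , _ , s⊆u , ∣s∣≡m = ⊆-interpolate m (λ x∈∅ → contradiction x∈∅ ∉⊥)
                              (subst (_≤ m) (sym (∣⊥∣≡0 n)) z≤n) m≤∣u∣
  in s , s⊆u , ∣s∣≡m

∣⁅x⁆∪⁅y⁆∣≡2 : ∀ (x y : Fin n) → x ≢ y → ∣ ⁅ x ⁆ ∪ ⁅ y ⁆ ∣ ≡ 2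
∣⁅x⁆∪⁅y⁆∣≡2 x y x≢y = trans (x∉p⇒∣p∪⁅x⁆∣≡1+∣p∣ ⁅ x ⁆ (x≢y ∘ sym ∘ x∈⁅y⁆⇒x≡y x))
                            (cong suc (∣⁅x⁆∣≡1 x))

z∈⁅x⁆∪⁅y⁆⇒z≡x⊎z≡y : ∀ {z} (x y : Fin n) → z ∈ ⁅ x ⁆ ∪ ⁅ y ⁆ → z ≡ x ⊎ z ≡ y
z∈⁅x⁆∪⁅y⁆⇒z≡x⊎z≡y x y z∈ with x∈p∪q⁻ ⁅ x ⁆ ⁅ y ⁆ z∈
... | inj₁ z∈⁅x⁆ = inj₁ (x∈⁅y⁆⇒x≡y x z∈⁅x⁆)
... | inj₂ z∈⁅y⁆ = inj₂ (x∈⁅y⁆⇒x≡y y z∈⁅y⁆)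

x≢y∧x≢z⇒x∉⁅y⁆∪⁅z⁆ : ∀ {x y z : Fin n} → x ≢ y → x ≢ z → x ∉ ⁅ y ⁆ ∪ ⁅ z ⁆
x≢y∧x≢z⇒x∉⁅y⁆∪⁅z⁆ {y = y} {z} x≢y x≢z x∈yz = [ x≢y , x≢z ]′ (z∈⁅x⁆∪⁅y⁆⇒z≡x⊎z≡y y z x∈yz)

∣⁅x⁆∪⁅y⁆∪⁅z⁆∣≡3 : ∀ (x y z : Fin n) → x ≢ y → x ≢ z → y ≢ z → ∣ (⁅ x ⁆ ∪ ⁅ y ⁆) ∪ ⁅ z ⁆ ∣ ≡ 3
∣⁅x⁆∪⁅y⁆∪⁅z⁆∣≡3 x y z x≢y x≢z y≢z =
  trans (x∉p⇒∣p∪⁅x⁆∣≡1+∣p∣ (⁅ x ⁆ ∪ ⁅ y ⁆) (x≢y∧x≢z⇒x∉⁅y⁆∪⁅z⁆ (x≢z ∘ sym) (y≢z ∘ sym)))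
        (cong suc (∣⁅x⁆∪⁅y⁆∣≡2 x y x≢y))

∣p∣≡2⇒p≡⁅x⁆∪⁅y⁆ : ∀ {p : Subset n} → ∣ p ∣ ≡ 2 → x ≢ y → x ∈ p → y ∈ p → p ≡ ⁅ x ⁆ ∪ ⁅ y ⁆
∣p∣≡2⇒p≡⁅x⁆∪⁅y⁆ {x = x} {y = y} ∣p∣≡2 x≢y x∈p y∈p =
  sym (⊆∧∣p∣≡∣q∣⇒p≡q (∪-lub (⁅x⁆⊆p x∈p) (⁅x⁆⊆p y∈p)) (trans (∣⁅x⁆∪⁅y⁆∣≡2 x y x≢y) (sym ∣p∣≡2)))

∣p∣≡2⇒∃-pair : ∀ (p : Subset n) → ∣ p ∣ ≡ 2 → ∃₂ λ x y → x ≢ y × p ≡ ⁅ x ⁆ ∪ ⁅ y ⁆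
∣p∣≡2⇒∃-pair p ∣p∣≡2
  with a , a∈p ← 0<∣p∣⇒Nonempty p (subst (0 <_) (sym ∣p∣≡2) (s≤s z≤n))
  with b , b∈p-a ← 0<∣p∣⇒Nonempty (p - a)
         (subst (0 <_) (suc-injective (trans (sym ∣p∣≡2) (x∈p⇒∣p∣≡1+∣p-x∣ p a∈p))) (s≤s z≤n))
  = let a≢b = λ a≡b → x∈p-y⇒x≢y p b∈p-a (sym a≡b)
    in a , b , a≢b , ∣p∣≡2⇒p≡⁅x⁆∪⁅y⁆ ∣p∣≡2 a≢b a∈p (p─q⊆p p ⁅ a ⁆ b∈p-a)

fromList : List (Fin n) → Subset n
fromList [] = ∅
fromList (x ∷ xs) = fromList xs ∪ ⁅ x ⁆

∈-fromList⁻ : ∀ (xs : List (Fin n)) → x ∈ fromList xs → x ∈ₗ xs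
∈-fromList⁻ [] x∈∅ = contradiction x∈∅ ∉⊥
∈-fromList⁻ (x ∷ xs) x∈ with x∈p∪q⁻ (fromList xs) ⁅ x ⁆ x∈
... | inj₁ y∈xs = Any.there (∈-fromList⁻ xs y∈xs)
... | inj₂ y∈⁅x⁆ = Any.here (x∈⁅y⁆⇒x≡y x y∈⁅x⁆)

∈-fromList⁺ : ∀ (xs : List (Fin n)) → x ∈ₗ xs → x ∈ fromList xs
∈-fromList⁺ (x ∷ xs) (Any.here refl) = x∈p∪q⁺ (inj₂ (x∈⁅x⁆ x))
∈-fromList⁺ (x ∷ xs) (Any.there y∈xs) = x∈p∪q⁺ (inj₁ (∈-fromList⁺ xs y∈xs))

∣fromList∣≡length : ∀ (xs : List (Fin n)) → Unique xs → ∣ fromList xs ∣ ≡ length xs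
∣fromList∣≡length {n} [] [] = ∣⊥∣≡0 n
∣fromList∣≡length (x ∷ xs) (x∉xs ∷ unique) =
  trans (x∉p⇒∣p∪⁅x⁆∣≡1+∣p∣ (fromList xs) (All¬⇒¬Any x∉xs ∘ ∈-fromList⁻ xs))
        (cong suc (∣fromList∣≡length xs unique))

Unique⇒length≤n : ∀ (xs : List (Fin n)) → Unique xs → length xs ≤ n
Unique⇒length≤n xs unique = subst (_≤ _) (∣fromList∣≡length xs unique) (∣p∣≤n (fromList xs))

elemOr : Fin n → Subset n → Fin n
elemOr d p with Fin.any? (_∈? p)
... | yes (x , _) = x
... | no _ = d

elemOr-∈ : ∀ d (p : Subset n) → Nonempty p → elemOr d p ∈ p
elemOr-∈ d p nonempty with Fin.any? (_∈? p)
... | yes (_ , x∈p) = x∈p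
... | no empty = contradiction nonempty empty

fromPred : {P : Fin n → Set} → Decidable P → Subset n
fromPred P? = tabulate (λ x → does (P? x))

∈-fromPred⁺ : ∀ {P : Fin n → Set} (P? : Decidable P) {x} → P x → x ∈ fromPred P?
∈-fromPred⁺ P? {x} px = lookup⇒[]= x _ (trans (lookup∘tabulate _ x) (dec-true (P? x) px))

∈-fromPred⁻ : ∀ {P : Fin n → Set} (P? : Decidable P) {x} → x ∈ fromPred P? → P x
∈-fromPred⁻ P? {x} x∈ with P? x | trans (sym (lookup∘tabulate _ x)) ([]=⇒lookup x∈)
... | yes px | _ = px

-- Maximal independent sets

hypergraph : (E : Subset n → Set) → Decidable E → Hypergraph n
hypergraph E E? = record { edge = λ S → ⌊ E? S ⌋ }

saturated⇒IsMIS : ∀ (H : Hypergraph n) I → Independent H I →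
                  (∀ x → x ∉ I → ∃ λ S → S ⊆ I ∪ ⁅ x ⁆ × IsEdge H S) → IsMIS H I
saturated⇒IsMIS H I independent saturated = independent , maximal
  where
  maximal : ∀ J → I ⊆ J → Independent H J → J ≡ I
  maximal J I⊆J J-independent with ∃∈∉? J I
  ... | no none = ⊆-antisym (¬∃∈∉⇒⊆ none) I⊆J
  ... | yes (x , x∈J , x∉I) =
    let S , S⊆I∪⁅x⁆ , S-edge = saturated x x∉I
    in contradiction S-edge (J-independent S (∪-lub I⊆J (⁅x⁆⊆p x∈J) ∘ S⊆I∪⁅x⁆))

Unique-map⁺-on : ∀ {A B : Set} {P : A → Set} {f : A → B} →
                 (∀ {x y} → P x → P y → f x ≡ f y → x ≡ y) →
                 ∀ {xs} → All P xs → Unique xs → Unique (map f xs)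
Unique-map⁺-on injective [] [] = []
Unique-map⁺-on {P = P} {f = f} injective (px ∷ pxs) (x∉xs ∷ unique) =
  distinct px pxs x∉xs ∷ Unique-map⁺-on injective pxs unique
  where
  distinct : ∀ {x ys} → P x → All P ys → All (x ≢_) ys → All (f x ≢_) (map f ys)
  distinct px [] [] = []
  distinct px (py ∷ pys) (x≢y ∷ x∉ys) = (x≢y ∘ injective px py) ∷ distinct px pys x∉ys

-- S is not independent, being a proper superset of the maximal I, and
-- uniformity leaves S itself as its only candidate edge.
⊇MIS⇒IsEdge : ∀ {k} {H : Hypergraph n} {I S} → Uniform (suc k) H → IsMISOfSize H k I →
              I ⊆ S → ∣ S ∣ ≡ suc k → IsEdge H S
⊇MIS⇒IsEdge {k = k} {H} {I} {S} uniform ((_ , maximal) , ∣I∣≡k) I⊆S ∣S∣≡1+k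
  with T? (edge H S)
... | yes S-edge = S-edge
... | no ¬S-edge = contradiction (trans (sym ∣S∣≡1+k) ∣S∣≡k) 1+n≢n
  where
  S-independent : Independent H S
  S-independent S′ S′⊆S S′-edge =
    ¬S-edge (subst (IsEdge H) (⊆∧∣p∣≡∣q∣⇒p≡q S′⊆S (trans (uniform S′ S′-edge) (sym ∣S∣≡1+k))) S′-edge)
  ∣S∣≡k : ∣ S ∣ ≡ k
  ∣S∣≡k = trans (cong ∣_∣ (maximal S I⊆S S-independent)) ∣I∣≡k

star-length≤n∸1 : ∀ a (L : List (Subset n)) → Unique L →
                  All (λ I → ∣ I ∣ ≡ 2) L → All (a ∈_) L → length L ≤ n ∸ 1
star-length≤n∸1 {n} a L unique pairs ∋a = begin
  length L                 ≡⟨ length-map other L ⟨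
  length (map other L)     ≤⟨ ∸-monoˡ-≤ 1 (Unique⇒length≤n (a ∷ map other L) (a∉others ∷ others-unique)) ⟩
  n ∸ 1                    ∎
  where
  open ≤-Reasoning
  other : Subset n → Fin n
  other I = elemOr a (I - a)
  Star : Subset n → Set
  Star I = ∣ I ∣ ≡ 2 × a ∈ I
  other∈I-a : ∀ {I} → Star I → other I ∈ I - a
  other∈I-a {I} (∣I∣≡2 , a∈I) = elemOr-∈ a (I - a) (0<∣p∣⇒Nonempty (I - a)
    (subst (0 <_) (suc-injective (trans (sym ∣I∣≡2) (x∈p⇒∣p∣≡1+∣p-x∣ I a∈I))) (s≤s z≤n)))
  a≢other : ∀ {I} → Star I → a ≢ other I
  a≢other {I} star a≡other = x∈p-y⇒x≢y I (other∈I-a star) (sym a≡other)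
  I≡⁅a⁆∪⁅other⁆ : ∀ {I} → Star I → I ≡ ⁅ a ⁆ ∪ ⁅ other I ⁆
  I≡⁅a⁆∪⁅other⁆ {I} star@(∣I∣≡2 , a∈I) =
    ∣p∣≡2⇒p≡⁅x⁆∪⁅y⁆ ∣I∣≡2 (a≢other star) a∈I (p─q⊆p I ⁅ a ⁆ (other∈I-a star))
  other-injective : ∀ {I J} → Star I → Star J → other I ≡ other J → I ≡ J
  other-injective starI starJ other≡ =
    trans (I≡⁅a⁆∪⁅other⁆ starI) (trans (cong (λ x → ⁅ a ⁆ ∪ ⁅ x ⁆) other≡) (sym (I≡⁅a⁆∪⁅other⁆ starJ)))
  stars : All Star L
  stars = All.zip (pairs , ∋a)
  others-unique : Unique (map other L)
  others-unique = Unique-map⁺-on other-injective stars unique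
  a∉others : All (a ≢_) (map other L)
  a∉others = All-map⁺ (All.map a≢other stars)

-- MIS's of size 2 in K₄³-free 3-graphs

module K₄-Free-3-Graph (H : Hypergraph n) (uniform : Uniform 3 H) (K₄-free : KFree 3 4 H) where

  MIS₂ : Subset n → Set
  MIS₂ = IsMISOfSize H 2

  every-vertex-avoided⇒K₄ : ∀ U → ∣ U ∣ ≡ 4 →
    (∀ {x} → x ∈ U → ∃ λ I → MIS₂ I × I ⊆ U × x ∉ I) → ContainsK 3 4 H
  every-vertex-avoided⇒K₄ U ∣U∣≡4 avoided = U , ∣U∣≡4 , triple-isEdge
    where
    triple-isEdge : ∀ S → S ⊆ U → ∣ S ∣ ≡ 3 → IsEdge H S
    triple-isEdge S S⊆U ∣S∣≡3
      with x , x∈U , x∉S ← ∣q∣<∣p∣⇒∃∈∉ U S (subst₂ _<_ (sym ∣S∣≡3) (sym ∣U∣≡4) ≤-refl)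
      with I , I-MIS₂ , I⊆U , x∉I ← avoided x∈U
      = ⊇MIS⇒IsEdge uniform I-MIS₂ (subst (I ⊆_) (sym S≡U-x) (p⊆q∧x∉p⇒p⊆q-x I⊆U x∉I)) ∣S∣≡3
      where
      S≡U-x : S ≡ U - x
      S≡U-x = ⊆∧∣p∣≡∣q∣⇒p≡q (p⊆q∧x∉p⇒p⊆q-x S⊆U x∉S)
                (suc-injective (trans (cong suc ∣S∣≡3) (trans (sym ∣U∣≡4) (x∈p⇒∣p∣≡1+∣p-x∣ U x∈U))))

  MIS₂-intersect : ∀ {I J} → MIS₂ I → MIS₂ J → ∃ λ x → x ∈ I × x ∈ J
  MIS₂-intersect {I} {J} I-MIS₂ J-MIS₂ with Fin.any? (λ x → (x ∈? I) ×-dec (x ∈? J))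
  ... | yes common = common
  ... | no disjoint = contradiction (every-vertex-avoided⇒K₄ (I ∪ J) ∣I∪J∣≡4 avoided) K₄-free
    where
    ∣I∪J∣≡4 : ∣ I ∪ J ∣ ≡ 4
    ∣I∪J∣≡4 = trans (disjoint⇒∣p∪q∣≡∣p∣+∣q∣ I J (λ x∈I x∈J → disjoint (_ , x∈I , x∈J)))
                    (cong₂ _+_ (proj₂ I-MIS₂) (proj₂ J-MIS₂))
    avoided : ∀ {x} → x ∈ I ∪ J → ∃ λ K → MIS₂ K × K ⊆ I ∪ J × x ∉ K
    avoided {x} _ with x ∈? I
    ... | yes x∈I = J , J-MIS₂ , q⊆p∪q I J , λ x∈J → disjoint (x , x∈I , x∈J)
    ... | no x∉I = I , I-MIS₂ , p⊆p∪q J , x∉I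

  pair-meets : ∀ {a b P} → MIS₂ (⁅ a ⁆ ∪ ⁅ b ⁆) → MIS₂ P → a ∉ P → b ∈ P
  pair-meets {a} {b} ab-MIS₂ P-MIS₂ a∉P with MIS₂-intersect ab-MIS₂ P-MIS₂
  ... | x , x∈ab , x∈P with z∈⁅x⁆∪⁅y⁆⇒z≡x⊎z≡y a b x∈ab
  ...   | inj₁ refl = contradiction x∈P a∉P
  ...   | inj₂ refl = x∈P

  triangle⇒K₄ : 4 ≤ n → ∀ {a b e} → a ≢ b → a ≢ e → b ≢ e → MIS₂ (⁅ a ⁆ ∪ ⁅ b ⁆) →
                MIS₂ (⁅ b ⁆ ∪ ⁅ e ⁆) → MIS₂ (⁅ a ⁆ ∪ ⁅ e ⁆) → ContainsK 3 4 H
  triangle⇒K₄ 4≤n {a} {b} {e} a≢b a≢e b≢e ab-MIS₂ be-MIS₂ ae-MIS₂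
    with d , _ , d∉V ← ∣q∣<∣p∣⇒∃∈∉ ⊤ ((⁅ a ⁆ ∪ ⁅ b ⁆) ∪ ⁅ e ⁆)
                         (subst₂ _<_ (sym (∣⁅x⁆∪⁅y⁆∪⁅z⁆∣≡3 a b e a≢b a≢e b≢e)) (sym (∣⊤∣≡n n)) 4≤n)
    = every-vertex-avoided⇒K₄ (V ∪ ⁅ d ⁆) (trans (x∉p⇒∣p∪⁅x⁆∣≡1+∣p∣ V d∉V) (cong suc ∣V∣≡3)) avoided
    where
    V : Subset n
    V = (⁅ a ⁆ ∪ ⁅ b ⁆) ∪ ⁅ e ⁆
    ∣V∣≡3 : ∣ V ∣ ≡ 3
    ∣V∣≡3 = ∣⁅x⁆∪⁅y⁆∪⁅z⁆∣≡3 a b e a≢b a≢e b≢e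
    ab⊆U : ⁅ a ⁆ ∪ ⁅ b ⁆ ⊆ V ∪ ⁅ d ⁆
    ab⊆U = p⊆p∪q ⁅ d ⁆ ∘ p⊆p∪q ⁅ e ⁆
    ⁅e⁆⊆U : ⁅ e ⁆ ⊆ V ∪ ⁅ d ⁆
    ⁅e⁆⊆U = p⊆p∪q ⁅ d ⁆ ∘ q⊆p∪q (⁅ a ⁆ ∪ ⁅ b ⁆) ⁅ e ⁆
    avoided : ∀ {x} → x ∈ V ∪ ⁅ d ⁆ → ∃ λ I → MIS₂ I × I ⊆ V ∪ ⁅ d ⁆ × x ∉ I
    avoided {x} _ with x Fin.≟ a | x Fin.≟ b
    ... | yes x≡a | _ = ⁅ b ⁆ ∪ ⁅ e ⁆ , be-MIS₂ , ∪-lub (ab⊆U ∘ q⊆p∪q ⁅ a ⁆ ⁅ b ⁆) ⁅e⁆⊆U ,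
          subst (_∉ ⁅ b ⁆ ∪ ⁅ e ⁆) (sym x≡a) (x≢y∧x≢z⇒x∉⁅y⁆∪⁅z⁆ a≢b a≢e)
    ... | no _ | yes x≡b = ⁅ a ⁆ ∪ ⁅ e ⁆ , ae-MIS₂ , ∪-lub (ab⊆U ∘ p⊆p∪q ⁅ b ⁆) ⁅e⁆⊆U ,
          subst (_∉ ⁅ a ⁆ ∪ ⁅ e ⁆) (sym x≡b) (x≢y∧x≢z⇒x∉⁅y⁆∪⁅z⁆ (a≢b ∘ sym) b≢e)
    ... | no x≢a | no x≢b = ⁅ a ⁆ ∪ ⁅ b ⁆ , ab-MIS₂ , ab⊆U , x≢y∧x≢z⇒x∉⁅y⁆∪⁅z⁆ x≢a x≢b

  avoiding-pair⇒K₄ : 4 ≤ n → ∀ {a b P Q} → a ≢ b → MIS₂ (⁅ a ⁆ ∪ ⁅ b ⁆) →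
                     MIS₂ P → a ∉ P → MIS₂ Q → b ∉ Q → ContainsK 3 4 H
  avoiding-pair⇒K₄ 4≤n {a} {b} {P} {Q} a≢b ab-MIS₂ P-MIS₂ a∉P Q-MIS₂ b∉Q
    with e , e∈P , e∈Q ← MIS₂-intersect P-MIS₂ Q-MIS₂
    = triangle⇒K₄ 4≤n a≢b a≢e b≢e ab-MIS₂ (subst MIS₂ P≡be P-MIS₂) (subst MIS₂ Q≡ae Q-MIS₂)
    where
    a≢e : a ≢ e
    a≢e refl = a∉P e∈P
    b≢e : b ≢ e
    b≢e refl = b∉Q e∈Q
    P≡be : P ≡ ⁅ b ⁆ ∪ ⁅ e ⁆
    P≡be = ∣p∣≡2⇒p≡⁅x⁆∪⁅y⁆ (proj₂ P-MIS₂) b≢e (pair-meets ab-MIS₂ P-MIS₂ a∉P) e∈P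
    Q≡ae : Q ≡ ⁅ a ⁆ ∪ ⁅ e ⁆
    Q≡ae = ∣p∣≡2⇒p≡⁅x⁆∪⁅y⁆ (proj₂ Q-MIS₂) a≢e
             (pair-meets (subst MIS₂ (∪-comm ⁅ a ⁆ ⁅ b ⁆) ab-MIS₂) Q-MIS₂ b∉Q) e∈Q

  MIS₂-count≤n∸1 : 4 ≤ n → ∀ L → Unique L → All MIS₂ L → length L ≤ n ∸ 1
  MIS₂-count≤n∸1 _ [] _ _ = z≤n
  MIS₂-count≤n∸1 4≤n (I ∷ L) unique MIS₂s
    with a , b , a≢b , I≡ab ← ∣p∣≡2⇒∃-pair I (proj₂ (All.head MIS₂s))
    with all? (a ∈?_) (I ∷ L) | all? (b ∈?_) (I ∷ L)
  ... | yes all∋a | _ = star-length≤n∸1 a (I ∷ L) unique (All.map proj₂ MIS₂s) all∋a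
  ... | no _ | yes all∋b = star-length≤n∸1 b (I ∷ L) unique (All.map proj₂ MIS₂s) all∋b
  ... | no ¬all∋a | no ¬all∋b =
    let P , P∈L , a∉P = find (¬All⇒Any¬ (a ∈?_) (I ∷ L) ¬all∋a)
        Q , Q∈L , b∉Q = find (¬All⇒Any¬ (b ∈?_) (I ∷ L) ¬all∋b)
    in contradiction (avoiding-pair⇒K₄ 4≤n a≢b (subst MIS₂ I≡ab (All.head MIS₂s))
                        (All.lookup MIS₂s P∈L) a∉P (All.lookup MIS₂s Q∈L) b∉Q) K₄-free

module Star (m : ℕ) where

  StarEdge : Subset (suc m) → Set
  StarEdge S = ∣ S ∣ ≡ 3 × zero ∈ S

  star : Hypergraph (suc m)
  star = hypergraph StarEdge (λ S → (∣ S ∣ ≟ 3) ×-dec (zero ∈? S))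

  star-uniform : Uniform 3 star
  star-uniform S S-edge = proj₁ (toWitness S-edge)

  star-K₄-free : KFree 3 4 star
  star-K₄-free (U , ∣U∣≡4 , complete)
    with S , S⊆U-0 , ∣S∣≡3 ← ∃-subset-of-size (U - zero) 3
                                (≤-pred (subst (_≤ suc ∣ U - zero ∣) ∣U∣≡4 (∣p∣≤1+∣p-x∣ U zero)))
    = x∈p-y⇒x≢y U (S⊆U-0 (proj₂ (toWitness (complete S (p─q⊆p U ⁅ zero ⁆ ∘ S⊆U-0) ∣S∣≡3)))) refl

  spoke : Fin m → Subset (suc m)
  spoke w = ⁅ zero ⁆ ∪ ⁅ suc w ⁆

  ∣spoke∣≡2 : ∀ w → ∣ spoke w ∣ ≡ 2
  ∣spoke∣≡2 w = ∣⁅x⁆∪⁅y⁆∣≡2 zero (suc w) (λ ())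

  spoke-MIS₂ : ∀ w → IsMISOfSize star 2 (spoke w)
  spoke-MIS₂ w = saturated⇒IsMIS star (spoke w) independent saturated , ∣spoke∣≡2 w
    where
    independent : Independent star (spoke w)
    independent S S⊆spoke S-edge =
      <⇒≱ (s≤s (s≤s (s≤s z≤n))) (subst₂ _≤_ (proj₁ (toWitness S-edge)) (∣spoke∣≡2 w) (p⊆q⇒∣p∣≤∣q∣ S⊆spoke))
    saturated : ∀ x → x ∉ spoke w → ∃ λ S → S ⊆ spoke w ∪ ⁅ x ⁆ × IsEdge star S
    saturated x x∉spoke = spoke w ∪ ⁅ x ⁆ , ⊆-refl ,
      fromWitness (trans (x∉p⇒∣p∪⁅x⁆∣≡1+∣p∣ (spoke w) x∉spoke) (cong suc (∣spoke∣≡2 w)) ,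
                   p⊆p∪q ⁅ x ⁆ (p⊆p∪q ⁅ suc w ⁆ (x∈⁅x⁆ zero)))

  spoke-injective : ∀ {v w} → spoke v ≡ spoke w → v ≡ w
  spoke-injective {v} {w} spoke≡
    with z∈⁅x⁆∪⁅y⁆⇒z≡x⊎z≡y zero (suc w) (subst (suc v ∈_) spoke≡ (q⊆p∪q ⁅ zero ⁆ ⁅ suc v ⁆ (x∈⁅x⁆ (suc v))))
  ... | inj₂ refl = refl

  star-MIS₂-count : AtLeastMIS star 2 m
  star-MIS₂-count = map spoke (allFin m) , Unique-map⁺ spoke-injective (allFin⁺ m) ,
    All-map⁺ (tabulate⁺ spoke-MIS₂) , trans (length-map spoke (allFin m)) (length-tabulate (λ w → w))

m₄³[n,2]≡n∸1 : ∀ n → 4 ≤ n → mEq 3 4 n 2 (n ∸ 1)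
m₄³[n,2]≡n∸1 (suc m) 4≤n = (star , star-uniform , star-K₄-free , star-MIS₂-count) ,
  λ H uniform K₄-free → K₄-Free-3-Graph.MIS₂-count≤n∸1 H uniform K₄-free 4≤n
  where open Star m

-- The cyclic construction

Fin-cover₂ : ∀ {k} → k ≡ 2 → (i j x : Fin k) → i ≢ j → x ≡ i ⊎ x ≡ j
Fin-cover₂ refl zero zero _ i≢j = contradiction refl i≢j
Fin-cover₂ refl (suc zero) (suc zero) _ i≢j = contradiction refl i≢j
Fin-cover₂ refl zero (suc zero) zero _ = inj₁ refl
Fin-cover₂ refl zero (suc zero) (suc zero) _ = inj₂ refl
Fin-cover₂ refl (suc zero) zero zero _ = inj₂ refl
Fin-cover₂ refl (suc zero) zero (suc zero) _ = inj₁ refl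

module ResidueClasses (k : ℕ) .{{_ : NonZero k}} (n : ℕ) where

  class : Fin n → Fin k
  class v = fromℕ< (m%n<n (toℕ v) k)

  toℕ-class : ∀ v → toℕ (class v) ≡ toℕ v % k
  toℕ-class v = Fin.toℕ-fromℕ< (m%n<n (toℕ v) k)

  Class : Fin k → Subset n
  Class i = fromPred (λ v → class v Fin.≟ i)

  count : Fin k → Subset n → ℕ
  count i S = ∣ S ∩ Class i ∣

  ∈-Class⁺ : ∀ {v i} → class v ≡ i → v ∈ Class i
  ∈-Class⁺ = ∈-fromPred⁺ (λ v → class v Fin.≟ _)

  ∈-Class⁻ : ∀ {v i} → v ∈ Class i → class v ≡ i
  ∈-Class⁻ = ∈-fromPred⁻ (λ v → class v Fin.≟ _)

  count-mono : ∀ i {S S′} → S ⊆ S′ → count i S ≤ count i S′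
  count-mono i {S} S⊆S′ = p⊆q⇒∣p∣≤∣q∣ λ x∈S∩C →
    let x∈S , x∈C = x∈p∩q⁻ S (Class i) x∈S∩C in x∈p∩q⁺ (S⊆S′ x∈S , x∈C)

  ⊆⇒≤count : ∀ i {A S m} → A ⊆ S → (∀ {x} → x ∈ A → class x ≡ i) → ∣ A ∣ ≡ m → m ≤ count i S
  ⊆⇒≤count i A⊆S A-in-i ∣A∣≡m =
    subst (_≤ _) ∣A∣≡m (p⊆q⇒∣p∣≤∣q∣ λ x∈A → x∈p∩q⁺ (A⊆S x∈A , ∈-Class⁺ (A-in-i x∈A)))

  ≤count⇒∃-subset : ∀ i S m → m ≤ count i S →
                    ∃ λ A → A ⊆ S × (∀ {x} → x ∈ A → class x ≡ i) × ∣ A ∣ ≡ m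
  ≤count⇒∃-subset i S m m≤count =
    let A , A⊆S∩C , ∣A∣≡m = ∃-subset-of-size (S ∩ Class i) m m≤count
    in A , p∩q⊆p S (Class i) ∘ A⊆S∩C , ∈-Class⁻ ∘ p∩q⊆q S (Class i) ∘ A⊆S∩C , ∣A∣≡m

  0<count⇒∃ : ∀ i S → 0 < count i S → ∃ λ x → x ∈ S × class x ≡ i
  0<count⇒∃ i S 0<count =
    let x , x∈S∩C = 0<∣p∣⇒Nonempty (S ∩ Class i) 0<count
        x∈S , x∈C = x∈p∩q⁻ S (Class i) x∈S∩C
    in x , x∈S , ∈-Class⁻ x∈C

  count[S-x]<count : ∀ i {S x} → x ∈ S → class x ≡ i → count i (S - x) < count i S
  count[S-x]<count i {S} {x} x∈S x-in-i = begin-strict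
    ∣ (S - x) ∩ Class i ∣ ≤⟨ p⊆q⇒∣p∣≤∣q∣ [S-x]∩C⊆[S∩C]-x ⟩
    ∣ (S ∩ Class i) - x ∣ <⟨ x∈p⇒∣p-x∣<∣p∣ (x∈p∩q⁺ (x∈S , ∈-Class⁺ x-in-i)) ⟩
    ∣ S ∩ Class i ∣       ∎
    where
    open ≤-Reasoning
    [S-x]∩C⊆[S∩C]-x : (S - x) ∩ Class i ⊆ (S ∩ Class i) - x
    [S-x]∩C⊆[S∩C]-x y∈ =
      let y∈S-x , y∈C = x∈p∩q⁻ (S - x) (Class i) y∈
      in x∈p∧x≢y⇒x∈p-y (x∈p∩q⁺ (p─q⊆p S ⁅ x ⁆ y∈S-x , y∈C)) (x∈p-y⇒x≢y S y∈S-x)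

  next : Fin k → Fin k
  next i = fromℕ< (m%n<n (suc (toℕ i)) k)

  toℕ-next : ∀ i → toℕ (next i) ≡ suc (toℕ i) ⊎ (suc (toℕ i) ≡ k × toℕ (next i) ≡ 0)
  toℕ-next i with suc (toℕ i) <? k
  ... | yes 1+i<k = inj₁ (trans (Fin.toℕ-fromℕ< _) (m<n⇒m%n≡m 1+i<k))
  ... | no 1+i≮k = inj₂ (1+i≡k , trans (Fin.toℕ-fromℕ< _) (trans (%-congˡ 1+i≡k) (n%n≡0 k)))
    where
    1+i≡k : suc (toℕ i) ≡ k
    1+i≡k = ≤-antisym (Fin.toℕ<n i) (≮⇒≥ 1+i≮k)

  next≢id : 2 ≤ k → ∀ i → next i ≢ i
  next≢id 2≤k i next-i≡i with toℕ-next i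
  ... | inj₁ next≡1+i = 1+n≢n (trans (sym next≡1+i) (cong toℕ next-i≡i))
  ... | inj₂ (1+i≡k , next≡0) =
    >⇒≢ 2≤k (trans (sym 1+i≡k) (cong suc (trans (sym (cong toℕ next-i≡i)) next≡0)))

  next²≡id⇒k≡2 : 2 ≤ k → ∀ i → next (next i) ≡ i → k ≡ 2
  next²≡id⇒k≡2 2≤k i next²≡i with toℕ-next i | toℕ-next (next i)
  ... | inj₁ j≡1+i | inj₁ next-j≡1+j =
    contradiction (trans (sym (cong toℕ next²≡i)) (trans next-j≡1+j (cong suc j≡1+i))) (m+1+n≢n 1 ∘ sym)
  ... | inj₁ j≡1+i | inj₂ (1+j≡k , next-j≡0) =
    trans (sym 1+j≡k) (cong suc (trans j≡1+i (cong suc (trans (sym (cong toℕ next²≡i)) next-j≡0))))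
  ... | inj₂ (1+i≡k , j≡0) | inj₁ next-j≡1+j =
    trans (sym 1+i≡k) (cong suc (trans (sym (cong toℕ next²≡i)) (trans next-j≡1+j (cong suc j≡0))))
  ... | inj₂ (_ , j≡0) | inj₂ (1+j≡k , _) = contradiction (trans (sym 1+j≡k) (cong suc j≡0)) (>⇒≢ 2≤k)

module CyclicHypergraph (k : ℕ) .{{_ : NonZero k}} (2≤k : 2 ≤ k) (n r : ℕ) where

  open ResidueClasses k n public

  CyclicEdge : Subset n → Set
  CyclicEdge S = ∣ S ∣ ≡ r ×
    ∃ λ i → count i S ≡ 2 × 1 ≤ count (next i) S × (∀ j → j ≢ i → count j S ≤ 1)

  cyclicEdge? : Decidable CyclicEdge
  cyclicEdge? S = (∣ S ∣ ≟ r) ×-dec Fin.any? λ i →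
    (count i S ≟ 2) ×-dec (1 ≤? count (next i) S) ×-dec Fin.all? λ j → ¬? (j Fin.≟ i) →-dec (count j S ≤? 1)

  cyclic : Hypergraph n
  cyclic = hypergraph CyclicEdge cyclicEdge?

  cyclic-uniform : Uniform r cyclic
  cyclic-uniform S S-edge = proj₁ (toWitness S-edge)

  3≤count⇒¬CyclicEdge : ∀ S i → 3 ≤ count i S → ¬ CyclicEdge S
  3≤count⇒¬CyclicEdge S i 3≤count (_ , i′ , count≡2 , _ , others≤1) with i Fin.≟ i′
  ... | yes refl = <⇒≱ (≤-reflexive (cong suc count≡2)) 3≤count
  ... | no i≢i′ = <⇒≱ (s≤s (s≤s z≤n)) (≤-trans 3≤count (others≤1 i i≢i′))

  two-doubled⇒¬CyclicEdge : ∀ S i j → i ≢ j → 2 ≤ count i S → 2 ≤ count j S → ¬ CyclicEdge S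
  two-doubled⇒¬CyclicEdge S i j i≢j 2≤i 2≤j (_ , i′ , _ , _ , others≤1) with i Fin.≟ i′
  ... | yes refl = <⇒≱ (s≤s (s≤s z≤n)) (≤-trans 2≤j (others≤1 j (i≢j ∘ sym)))
  ... | no i≢i′ = <⇒≱ (s≤s (s≤s z≤n)) (≤-trans 2≤i (others≤1 i i≢i′))

  count≤1⇒¬CyclicEdge : ∀ S → (∀ i → count i S ≤ 1) → ¬ CyclicEdge S
  count≤1⇒¬CyclicEdge S all≤1 (_ , i , count≡2 , _) = <⇒≱ (s≤s (s≤s z≤n)) (subst (_≤ 1) count≡2 (all≤1 i))

  CyclicEdge⇒1≤count-next : ∀ {S i} → CyclicEdge S → 2 ≤ count i S → 1 ≤ count (next i) S
  CyclicEdge⇒1≤count-next {S} {i} (_ , i′ , _ , 1≤next , others≤1) 2≤count with i Fin.≟ i′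
  ... | yes refl = 1≤next
  ... | no i≢i′ = contradiction (≤-trans 2≤count (others≤1 i i≢i′)) (<⇒≱ (s≤s (s≤s z≤n)))

  module Clique (3≤r : 3 ≤ r) (U : Subset n) (r<∣U∣ : r < ∣ U ∣)
                (complete : ∀ S → S ⊆ U → ∣ S ∣ ≡ r → CyclicEdge S) where

    r≤∣U∣ : r ≤ ∣ U ∣
    r≤∣U∣ = <⇒≤ r<∣U∣

    edge-⊇ : ∀ A → A ⊆ U → ∣ A ∣ ≤ r → ∃ λ S → A ⊆ S × CyclicEdge S
    edge-⊇ A A⊆U ∣A∣≤r =
      let S , A⊆S , S⊆U , ∣S∣≡r = ⊆-interpolate r A⊆U ∣A∣≤r r≤∣U∣
      in S , A⊆S , complete S S⊆U ∣S∣≡r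

    spread-subset⇒⊥ : ∀ U′ → U′ ⊆ U → r ≤ ∣ U′ ∣ → (∀ j → count j U′ ≤ 1) → ⊥
    spread-subset⇒⊥ U′ U′⊆U r≤∣U′∣ all≤1 =
      let S , S⊆U′ , ∣S∣≡r = ∃-subset-of-size U′ r r≤∣U′∣
      in count≤1⇒¬CyclicEdge S (λ j → ≤-trans (count-mono j S⊆U′) (all≤1 j)) (complete S (U′⊆U ∘ S⊆U′) ∣S∣≡r)

    count≤2 : ∀ i → count i U ≤ 2
    count≤2 i with 3 ≤? count i U
    ... | no 3≰count = ≤-pred (≰⇒> 3≰count)
    ... | yes 3≤count =
      let A , A⊆U , A-in-i , ∣A∣≡3 = ≤count⇒∃-subset i U 3 3≤count
          S , A⊆S , S-edge = edge-⊇ A A⊆U (subst (_≤ r) (sym ∣A∣≡3) 3≤r)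
      in contradiction S-edge (3≤count⇒¬CyclicEdge S i (⊆⇒≤count i A⊆S A-in-i ∣A∣≡3))

    two-doubled⇒r≡3 : ∀ {i j} → i ≢ j → 2 ≤ count i U → 2 ≤ count j U → r ≡ 3
    two-doubled⇒r≡3 {i} {j} i≢j 2≤i 2≤j with r ≟ 3
    ... | yes r≡3 = r≡3
    ... | no r≢3 =
      let Ai , Ai⊆U , Ai-in-i , ∣Ai∣≡2 = ≤count⇒∃-subset i U 2 2≤i
          Aj , Aj⊆U , Aj-in-j , ∣Aj∣≡2 = ≤count⇒∃-subset j U 2 2≤j
          ∣A∣≡4 = trans (disjoint⇒∣p∪q∣≡∣p∣+∣q∣ Ai Aj λ x∈Ai x∈Aj → i≢j (trans (sym (Ai-in-i x∈Ai)) (Aj-in-j x∈Aj)))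
                        (cong₂ _+_ ∣Ai∣≡2 ∣Aj∣≡2)
          S , A⊆S , S-edge = edge-⊇ (Ai ∪ Aj) (∪-lub Ai⊆U Aj⊆U)
                                    (subst (_≤ r) (sym ∣A∣≡4) (≤∧≢⇒< 3≤r (r≢3 ∘ sym)))
      in contradiction S-edge (two-doubled⇒¬CyclicEdge S i j i≢j
           (⊆⇒≤count i (A⊆S ∘ p⊆p∪q Aj) Ai-in-i ∣Ai∣≡2) (⊆⇒≤count j (A⊆S ∘ q⊆p∪q Ai Aj) Aj-in-j ∣Aj∣≡2))

    doubled⇒next≡ : r ≡ 3 → ∀ {i j} → i ≢ j → 2 ≤ count i U → 1 ≤ count j U → next i ≡ j
    doubled⇒next≡ r≡3 {i} {j} i≢j 2≤i 1≤j
      with A , A⊆U , A-in-i , ∣A∣≡2 ← ≤count⇒∃-subset i U 2 2≤i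
      with b , b∈U , b-in-j ← 0<count⇒∃ j U 1≤j
      with A∪b-edge ← complete (A ∪ ⁅ b ⁆) (∪-lub A⊆U (⁅x⁆⊆p b∈U))
             (trans (x∉p⇒∣p∪⁅x⁆∣≡1+∣p∣ A (λ b∈A → i≢j (trans (sym (A-in-i b∈A)) b-in-j)))
                    (trans (cong suc ∣A∣≡2) (sym r≡3)))
      with y , y∈A∪b , y-in-next ← 0<count⇒∃ (next i) (A ∪ ⁅ b ⁆)
             (CyclicEdge⇒1≤count-next {A ∪ ⁅ b ⁆} {i} A∪b-edge
               (⊆⇒≤count i (p⊆p∪q ⁅ b ⁆) A-in-i ∣A∣≡2))
      with x∈p∪q⁻ A ⁅ b ⁆ y∈A∪b
    ... | inj₁ y∈A = contradiction (trans (sym y-in-next) (A-in-i y∈A)) (next≢id 2≤k i)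
    ... | inj₂ y∈⁅b⁆ = trans (sym y-in-next) (trans (cong class (x∈⁅y⁆⇒x≡y b y∈⁅b⁆)) b-in-j)

    two-doubled⇒exceptional : ∀ {i j} → i ≢ j → 2 ≤ count i U → 2 ≤ count j U →
                              r ≡ 3 × ∣ U ∣ ≡ 4 × k ≡ 2
    two-doubled⇒exceptional {i} {j} i≢j 2≤i 2≤j = r≡3 , ≤-antisym ∣U∣≤4 (subst (_< ∣ U ∣) r≡3 r<∣U∣) , k≡2
      where
      r≡3 : r ≡ 3
      r≡3 = two-doubled⇒r≡3 i≢j 2≤i 2≤j
      k≡2 : k ≡ 2
      k≡2 = next²≡id⇒k≡2 2≤k i (trans (cong next (doubled⇒next≡ r≡3 i≢j 2≤i (≤-trans (s≤s z≤n) 2≤j)))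
                                        (doubled⇒next≡ r≡3 (i≢j ∘ sym) 2≤j (≤-trans (s≤s z≤n) 2≤i)))
      U⊆Ui∪Uj : U ⊆ (U ∩ Class i) ∪ (U ∩ Class j)
      U⊆Ui∪Uj {v} v∈U = x∈p∪q⁺ (Sum.map (λ v-in-i → x∈p∩q⁺ (v∈U , ∈-Class⁺ v-in-i))
                                         (λ v-in-j → x∈p∩q⁺ (v∈U , ∈-Class⁺ v-in-j))
                                         (Fin-cover₂ k≡2 i j (class v) i≢j))
      ∣U∣≤4 : ∣ U ∣ ≤ 4
      ∣U∣≤4 = begin
        ∣ U ∣                                 ≤⟨ p⊆q⇒∣p∣≤∣q∣ U⊆Ui∪Uj ⟩
        ∣ (U ∩ Class i) ∪ (U ∩ Class j) ∣     ≤⟨ ∣p∪q∣≤∣p∣+∣q∣ (U ∩ Class i) (U ∩ Class j) ⟩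
        count i U + count j U                 ≤⟨ +-mono-≤ (count≤2 i) (count≤2 j) ⟩
        4                                     ∎
        where open ≤-Reasoning

    count≤1-except : ∀ i → (∀ j → j ≢ i → count j U ≤ 1) →
                     ∀ {U′} → U′ ⊆ U → count i U′ ≤ 1 → ∀ j → count j U′ ≤ 1
    count≤1-except i others≤1 U′⊆U i≤1 j with j Fin.≟ i
    ... | yes refl = i≤1
    ... | no j≢i = ≤-trans (count-mono j U′⊆U) (others≤1 j j≢i)

    one-doubled⇒⊥ : ∀ i → (∀ j → j ≢ i → count j U ≤ 1) → ⊥
    one-doubled⇒⊥ i others≤1 with count i U ≤? 1
    ... | yes i≤1 = spread-subset⇒⊥ U ⊆-refl r≤∣U∣ (count≤1-except i others≤1 ⊆-refl i≤1)
    ... | no i≰1 with x , x∈U , x-in-i ← 0<count⇒∃ i U (≤-trans (s≤s z≤n) (≰⇒> i≰1)) =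
      spread-subset⇒⊥ (U - x) (p─q⊆p U ⁅ x ⁆) (≤-pred (subst (r <_) (x∈p⇒∣p∣≡1+∣p-x∣ U x∈U) r<∣U∣))
        (count≤1-except i others≤1 (p─q⊆p U ⁅ x ⁆)
          (≤-pred (≤-trans (count[S-x]<count i x∈U x-in-i) (count≤2 i))))

    exceptional : r ≡ 3 × ∣ U ∣ ≡ 4 × k ≡ 2
    exceptional with Fin.any? (λ i → 2 ≤? count i U)
    ... | no none-doubled =
      ⊥-elim (spread-subset⇒⊥ U ⊆-refl r≤∣U∣ (λ j → ≤-pred (≰⇒> (none-doubled ∘ (j ,_)))))
    ... | yes (i , 2≤i) with Fin.any? (λ j → ¬? (j Fin.≟ i) ×-dec (2 ≤? count j U))
    ...   | yes (j , j≢i , 2≤j) = two-doubled⇒exceptional (j≢i ∘ sym) 2≤i 2≤j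
    ...   | no no-other = ⊥-elim (one-doubled⇒⊥ i (λ j j≢i → ≤-pred (≰⇒> λ 2≤j → no-other (j , j≢i , 2≤j))))

  cyclic-K-free : 3 ≤ r → ∀ t → r < t → ¬ (r ≡ 3 × t ≡ 4 × k ≡ 2) → KFree r t cyclic
  cyclic-K-free 3≤r t r<t non-exceptional (U , ∣U∣≡t , complete) =
    let r≡3 , ∣U∣≡4 , k≡2 = Clique.exceptional 3≤r U (subst (r <_) (sym ∣U∣≡t) r<t)
                              (λ S S⊆U ∣S∣≡r → toWitness (complete S S⊆U ∣S∣≡r))
    in non-exceptional (r≡3 , trans (sym ∣U∣≡t) ∣U∣≡4 , k≡2)

-- Counting transversals

product : Vec ℕ m → ℕ
product [] = 1
product (x ∷ xs) = x * product xs

product-tabulate-const : ∀ m a → product (tabulate {n = m} (λ _ → a)) ≡ a ^ m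
product-tabulate-const zero a = refl
product-tabulate-const (suc m) a = cong (a *_) (product-tabulate-const m a)

product-tabulate-split : ∀ {m} s a b → s ≤ m →
  product (tabulate {n = m} (λ i → if does (toℕ i <? s) then a else b)) ≡ a ^ s * b ^ (m ∸ s)
product-tabulate-split {m} zero a b _ = trans (product-tabulate-const m b) (sym (+-identityʳ _))
product-tabulate-split {suc m} (suc s) a b (s≤s s≤m) =
  trans (cong (a *_) (product-tabulate-split s a b s≤m)) (sym (*-assoc a _ _))

length-cartesianProductWith : ∀ {A B C : Set} (f : A → B → C) xs ys →
                              length (cartesianProductWith f xs ys) ≡ length xs * length ys
length-cartesianProductWith f [] ys = refl
length-cartesianProductWith f (x ∷ xs) ys =
  trans (length-++ (map (f x) ys)) (cong₂ _+_ (length-map (f x) ys) (length-cartesianProductWith f xs ys))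

boundedVectors : Vec ℕ m → List (Vec ℕ m)
boundedVectors [] = [] ∷ []
boundedVectors (b ∷ bs) = cartesianProductWith _∷_ (upTo b) (boundedVectors bs)

length-boundedVectors : ∀ (bs : Vec ℕ m) → length (boundedVectors bs) ≡ product bs
length-boundedVectors [] = refl
length-boundedVectors (b ∷ bs) = trans (length-cartesianProductWith _∷_ (upTo b) (boundedVectors bs))
                                       (cong₂ _*_ (length-upTo b) (length-boundedVectors bs))

boundedVectors-unique : ∀ (bs : Vec ℕ m) → Unique (boundedVectors bs)
boundedVectors-unique [] = [] ∷ []
boundedVectors-unique (b ∷ bs) = cartesianProductWith⁺ _∷_ ∷-injective (upTo⁺ b) (boundedVectors-unique bs)

∈-boundedVectors⁻ : ∀ (bs : Vec ℕ m) {c} → c ∈ₗ boundedVectors bs → ∀ i → lookup c i < lookup bs i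
∈-boundedVectors⁻ (b ∷ bs) c∈ i with ∈-cartesianProductWith⁻ _∷_ (upTo b) (boundedVectors bs) c∈
∈-boundedVectors⁻ (b ∷ bs) c∈ zero | _ , _ , a∈ , _ , refl = ∈-upTo⁻ a∈
∈-boundedVectors⁻ (b ∷ bs) c∈ (suc i) | _ , _ , _ , cs∈ , refl = ∈-boundedVectors⁻ bs cs∈ i

⌈n/k⌉≡1+n/k : ∀ n k .{{_ : NonZero k}} → 0 < n % k → ⌈ n / k ⌉ ≡ suc (n / k)
⌈n/k⌉≡1+n/k n (suc k′) 0<n%k with n % suc k′ in n%k≡ | 0<n%k
... | suc s′ | _ = begin
  (n + k′) / suc k′                    ≡⟨ /-congˡ n+k′≡ ⟩
  (s′ + suc q * suc k′) / suc k′       ≡⟨ +-distrib-/-∣ʳ s′ (n∣m*n (suc q)) ⟩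
  s′ / suc k′ + suc q * suc k′ / suc k′ ≡⟨ cong₂ _+_ (m<n⇒m/n≡0 s′<k) (m*n/n≡m (suc q) (suc k′)) ⟩
  suc q                                ∎
  where
  open ≡-Reasoning
  q : ℕ
  q = n / suc k′
  s′<k : s′ < suc k′
  s′<k = ≤-trans (n≤1+n (suc s′)) (subst (_< suc k′) n%k≡ (m%n<n n (suc k′)))
  n+k′≡ : n + k′ ≡ s′ + suc q * suc k′
  n+k′≡ = trans (cong (_+ k′) (trans (m≡m%n+[m/n]*n n (suc k′)) (cong (_+ q * suc k′) n%k≡)))
                (solve 3 (λ s k qk → (con 1 :+ s :+ qk) :+ k := s :+ ((con 1 :+ k) :+ qk))
                         refl s′ k′ (q * suc k′))
    where open +-*-Solver

⌈n/k⌉^[n%k]≡[1+n/k]^[n%k] : ∀ n k .{{_ : NonZero k}} → ⌈ n / k ⌉ ^ (n % k) ≡ suc (n / k) ^ (n % k)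
⌈n/k⌉^[n%k]≡[1+n/k]^[n%k] n k with n % k in n%k≡
... | zero = refl
... | suc s′ = cong (_^ suc s′) (⌈n/k⌉≡1+n/k n k (subst (0 <_) (sym n%k≡) (s≤s z≤n)))

module Transversals (k : ℕ) .{{_ : NonZero k}} (2≤k : 2 ≤ k) (n r : ℕ)
                   (3≤r : 3 ≤ r) (r≤1+k : r ≤ suc k) where

  open CyclicHypergraph k 2≤k n r public

  q s : ℕ
  q = n / k
  s = n % k

  n≡s+q*k : n ≡ s + q * k
  n≡s+q*k = m≡m%n+[m/n]*n n k

  -- Class i consists of the vertices i + a k with a < classSize i.
  classSize : Fin k → ℕ
  classSize i = if does (toℕ i <? s) then suc q else q

  vertex-bound : ∀ i a → a < classSize i → toℕ i + a * k < n
  vertex-bound i a = bound (toℕ i <? s)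
    where
    open ≤-Reasoning
    bound : (i<s? : Dec (toℕ i < s)) → a < (if does i<s? then suc q else q) → toℕ i + a * k < n
    bound (yes i<s) a≤q = begin-strict
      toℕ i + a * k <⟨ +-monoˡ-< (a * k) i<s ⟩
      s + a * k     ≤⟨ +-monoʳ-≤ s (*-monoˡ-≤ k (≤-pred a≤q)) ⟩
      s + q * k     ≡⟨ n≡s+q*k ⟨
      n             ∎
    bound (no _) a<q = begin-strict
      toℕ i + a * k <⟨ +-monoˡ-< (a * k) (Fin.toℕ<n i) ⟩
      suc a * k     ≤⟨ *-monoˡ-≤ k a<q ⟩
      q * k         ≤⟨ m≤n+m (q * k) s ⟩
      s + q * k     ≡⟨ n≡s+q*k ⟨
      n             ∎

  transversal : Vec ℕ k → Subset n
  transversal c = fromPred (λ v → toℕ v ≟ toℕ (class v) + lookup c (class v) * k)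

  ∈-transversal⁻ : ∀ c {v} → v ∈ transversal c → toℕ v ≡ toℕ (class v) + lookup c (class v) * k
  ∈-transversal⁻ c = ∈-fromPred⁻ (λ v → toℕ v ≟ toℕ (class v) + lookup c (class v) * k)

  Choice : Vec ℕ k → Set
  Choice c = ∀ i → lookup c i < classSize i

  module _ (c : Vec ℕ k) (c<size : Choice c) where

    T : Subset n
    T = transversal c

    vertex : Fin k → Fin n
    vertex i = fromℕ< (vertex-bound i (lookup c i) (c<size i))

    toℕ-vertex : ∀ i → toℕ (vertex i) ≡ toℕ i + lookup c i * k
    toℕ-vertex i = Fin.toℕ-fromℕ< _

    class-vertex : ∀ i → class (vertex i) ≡ i
    class-vertex i = Fin.toℕ-injective (begin
      toℕ (class (vertex i))     ≡⟨ toℕ-class (vertex i) ⟩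
      toℕ (vertex i) % k         ≡⟨ %-congˡ (toℕ-vertex i) ⟩
      (toℕ i + lookup c i * k) % k ≡⟨ [m+kn]%n≡m%n (toℕ i) (lookup c i) k ⟩
      toℕ i % k                  ≡⟨ m<n⇒m%n≡m (Fin.toℕ<n i) ⟩
      toℕ i                      ∎)
      where open ≡-Reasoning

    vertex∈T : ∀ i → vertex i ∈ T
    vertex∈T i = ∈-fromPred⁺ (λ v → toℕ v ≟ toℕ (class v) + lookup c (class v) * k)
      (subst (λ j → toℕ (vertex i) ≡ toℕ j + lookup c j * k) (sym (class-vertex i)) (toℕ-vertex i))

    ∈T⇒≡vertex : ∀ {v} → v ∈ T → v ≡ vertex (class v)
    ∈T⇒≡vertex {v} v∈T = Fin.toℕ-injective (trans (∈-transversal⁻ c v∈T) (sym (toℕ-vertex (class v))))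

    ∈T∩Class⇒≡vertex : ∀ {v i} → v ∈ T → v ∈ Class i → v ≡ vertex i
    ∈T∩Class⇒≡vertex v∈T v∈Ci = trans (∈T⇒≡vertex v∈T) (cong vertex (∈-Class⁻ v∈Ci))

    count-T : ∀ i → count i T ≡ 1
    count-T i = trans (cong ∣_∣ (⊆-antisym T∩Ci⊆⁅vertex⁆ ⁅vertex⁆⊆T∩Ci)) (∣⁅x⁆∣≡1 (vertex i))
      where
      T∩Ci⊆⁅vertex⁆ : T ∩ Class i ⊆ ⁅ vertex i ⁆
      T∩Ci⊆⁅vertex⁆ v∈ =
        let v∈T , v∈Ci = x∈p∩q⁻ T (Class i) v∈
        in subst (_∈ ⁅ vertex i ⁆) (sym (∈T∩Class⇒≡vertex v∈T v∈Ci)) (x∈⁅x⁆ (vertex i))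
      ⁅vertex⁆⊆T∩Ci : ⁅ vertex i ⁆ ⊆ T ∩ Class i
      ⁅vertex⁆⊆T∩Ci = ⁅x⁆⊆p (x∈p∩q⁺ (vertex∈T i , ∈-Class⁺ (class-vertex i)))

    ∣T∣≡k : ∣ T ∣ ≡ k
    ∣T∣≡k = begin
      ∣ T ∣                                ≡⟨ cong ∣_∣ (⊆-antisym T⊆vertices vertices⊆T) ⟩
      ∣ fromList (map vertex (allFin k)) ∣ ≡⟨ ∣fromList∣≡length _ (Unique-map⁺ vertex-injective (allFin⁺ k)) ⟩
      length (map vertex (allFin k))       ≡⟨ length-map vertex (allFin k) ⟩
      length (allFin k)                    ≡⟨ length-tabulate (λ i → i) ⟩
      k                                    ∎
      where
      open ≡-Reasoning
      vertex-injective : ∀ {i j} → vertex i ≡ vertex j → i ≡ j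
      vertex-injective {i} {j} vi≡vj = trans (sym (class-vertex i)) (trans (cong class vi≡vj) (class-vertex j))
      T⊆vertices : T ⊆ fromList (map vertex (allFin k))
      T⊆vertices {v} v∈T = ∈-fromList⁺ _ (subst (_∈ₗ map vertex (allFin k)) (sym (∈T⇒≡vertex v∈T))
                                              (∈-map⁺ vertex (∈-allFin (class v))))
      vertices⊆T : fromList (map vertex (allFin k)) ⊆ T
      vertices⊆T v∈ with i , _ , refl ← ∈-map⁻ vertex (∈-fromList⁻ (map vertex (allFin k)) v∈) = vertex∈T i

    witnesses : Fin n → Subset n
    witnesses v = (⁅ vertex (class v) ⁆ ∪ ⁅ v ⁆) ∪ ⁅ vertex (next (class v)) ⁆

    ∣witnesses∣≡3 : ∀ {v} → v ∉ T → ∣ witnesses v ∣ ≡ 3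
    ∣witnesses∣≡3 {v} v∉T = ∣⁅x⁆∪⁅y⁆∪⁅z⁆∣≡3 (vertex i) v (vertex (next i))
      (λ x≡v → v∉T (subst (_∈ T) x≡v (vertex∈T i)))
      (λ x≡y → next≢id 2≤k i (trans (sym (class-vertex (next i)))
                                    (trans (cong class (sym x≡y)) (class-vertex i))))
      (λ v≡y → next≢id 2≤k i (trans (sym (class-vertex (next i))) (cong class (sym v≡y))))
      where
      i : Fin k
      i = class v

    witnesses⊆T∪⁅v⁆ : ∀ v → witnesses v ⊆ T ∪ ⁅ v ⁆
    witnesses⊆T∪⁅v⁆ v = ∪-lub (∪-lub (⁅x⁆⊆p (p⊆p∪q ⁅ v ⁆ (vertex∈T (class v))))
                                      (⁅x⁆⊆p (q⊆p∪q T ⁅ v ⁆ (x∈⁅x⁆ v))))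
                              (⁅x⁆⊆p (p⊆p∪q ⁅ v ⁆ (vertex∈T (next (class v)))))

    witnesses⊆S⊆T∪⁅v⁆⇒CyclicEdge : ∀ {v S} → v ∉ T → witnesses v ⊆ S → S ⊆ T ∪ ⁅ v ⁆ → ∣ S ∣ ≡ r → CyclicEdge S
    witnesses⊆S⊆T∪⁅v⁆⇒CyclicEdge {v} {S} v∉T witnesses⊆S S⊆T∪v ∣S∣≡r = ∣S∣≡r , class v , count-i≡2 , 1≤count-next , others≤1
      where
      i : Fin k
      i = class v
      x≢v : vertex i ≢ v
      x≢v x≡v = v∉T (subst (_∈ T) x≡v (vertex∈T i))
      count-i≡2 : count i S ≡ 2
      count-i≡2 = ≤-antisym
        (subst (count i S ≤_) (∣⁅x⁆∪⁅y⁆∣≡2 (vertex i) v x≢v) (p⊆q⇒∣p∣≤∣q∣ S∩Ci⊆xv))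
        (⊆⇒≤count i (witnesses⊆S ∘ p⊆p∪q _) xv-in-i (∣⁅x⁆∪⁅y⁆∣≡2 (vertex i) v x≢v))
        where
        S∩Ci⊆xv : S ∩ Class i ⊆ ⁅ vertex i ⁆ ∪ ⁅ v ⁆
        S∩Ci⊆xv w∈ with w∈S , w∈Ci ← x∈p∩q⁻ S (Class i) w∈ with x∈p∪q⁻ T ⁅ v ⁆ (S⊆T∪v w∈S)
        ... | inj₁ w∈T = x∈p∪q⁺ (inj₁ (subst (_∈ ⁅ vertex i ⁆) (sym (∈T∩Class⇒≡vertex w∈T w∈Ci)) (x∈⁅x⁆ _)))
        ... | inj₂ w∈⁅v⁆ = x∈p∪q⁺ (inj₂ w∈⁅v⁆)
        xv-in-i : ∀ {w} → w ∈ ⁅ vertex i ⁆ ∪ ⁅ v ⁆ → class w ≡ i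
        xv-in-i w∈ with z∈⁅x⁆∪⁅y⁆⇒z≡x⊎z≡y (vertex i) v w∈
        ... | inj₁ refl = class-vertex i
        ... | inj₂ refl = refl
      1≤count-next : 1 ≤ count (next i) S
      1≤count-next = x∈p⇒0<∣p∣ (x∈p∩q⁺ (witnesses⊆S (q⊆p∪q _ _ (x∈⁅x⁆ _)) , ∈-Class⁺ (class-vertex (next i))))
      others≤1 : ∀ j → j ≢ i → count j S ≤ 1
      others≤1 j j≢i = subst (count j S ≤_) (count-T j) (p⊆q⇒∣p∣≤∣q∣ S∩Cj⊆T∩Cj)
        where
        S∩Cj⊆T∩Cj : S ∩ Class j ⊆ T ∩ Class j
        S∩Cj⊆T∩Cj w∈ with w∈S , w∈Cj ← x∈p∩q⁻ S (Class j) w∈ with x∈p∪q⁻ T ⁅ v ⁆ (S⊆T∪v w∈S)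
        ... | inj₁ w∈T = x∈p∩q⁺ (w∈T , w∈Cj)
        ... | inj₂ w∈⁅v⁆ = contradiction (trans (sym (∈-Class⁻ w∈Cj)) (cong class (x∈⁅y⁆⇒x≡y v w∈⁅v⁆))) j≢i

    T-MIS : IsMISOfSize cyclic k T
    T-MIS = saturated⇒IsMIS cyclic T independent saturated , ∣T∣≡k
      where
      independent : Independent cyclic T
      independent S S⊆T S-edge =
        let _ , i , count≡2 , _ = toWitness S-edge
        in <⇒≱ (s≤s (s≤s z≤n)) (subst₂ _≤_ count≡2 (count-T i) (count-mono i S⊆T))
      saturated : ∀ v → v ∉ T → ∃ λ S → S ⊆ T ∪ ⁅ v ⁆ × IsEdge cyclic S
      saturated v v∉T =
        let S , witnesses⊆S , S⊆T∪v , ∣S∣≡r = ⊆-interpolate r (witnesses⊆T∪⁅v⁆ v)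
              (subst (_≤ r) (sym (∣witnesses∣≡3 v∉T)) 3≤r)
              (subst (r ≤_) (sym (trans (x∉p⇒∣p∪⁅x⁆∣≡1+∣p∣ T v∉T) (cong suc ∣T∣≡k))) r≤1+k)
        in S , S⊆T∪v , fromWitness (witnesses⊆S⊆T∪⁅v⁆⇒CyclicEdge v∉T witnesses⊆S S⊆T∪v ∣S∣≡r)

  transversal-injective : ∀ {c c′} → Choice c → Choice c′ → transversal c ≡ transversal c′ → c ≡ c′
  transversal-injective {c} {c′} c<size c′<size T≡T′ =
    trans (sym (tabulate∘lookup c)) (trans (tabulate-cong c≗c′) (tabulate∘lookup c′))
    where
    c≗c′ : ∀ i → lookup c i ≡ lookup c′ i
    c≗c′ i = *-cancelʳ-≡ _ _ k (+-cancelˡ-≡ (toℕ i) _ _ (begin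
      toℕ i + lookup c i * k                 ≡⟨ toℕ-vertex c c<size i ⟨
      toℕ (vertex c c<size i)                ≡⟨ ∈-transversal⁻ c′ (subst (_ ∈_) T≡T′ (vertex∈T c c<size i)) ⟩
      toℕ (class (vertex c c<size i)) + lookup c′ (class (vertex c c<size i)) * k
                                             ≡⟨ cong (λ j → toℕ j + lookup c′ j * k) (class-vertex c c<size i) ⟩
      toℕ i + lookup c′ i * k                ∎))
      where open ≡-Reasoning

  cyclic-MIS-count : AtLeastMIS cyclic k (suc q ^ s * q ^ (k ∸ s))
  cyclic-MIS-count = map transversal choices ,
    Unique-map⁺-on transversal-injective all-choices (boundedVectors-unique sizes) ,
    All-map⁺ (All.map (λ {c} → T-MIS c) all-choices) ,
    (begin
      length (map transversal choices) ≡⟨ length-map transversal choices ⟩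
      length choices                   ≡⟨ length-boundedVectors sizes ⟩
      product sizes                    ≡⟨ product-tabulate-split s (suc q) q (<⇒≤ (m%n<n n k)) ⟩
      suc q ^ s * q ^ (k ∸ s)          ∎)
    where
    open ≡-Reasoning
    sizes : Vec ℕ k
    sizes = tabulate classSize
    choices : List (Vec ℕ k)
    choices = boundedVectors sizes
    all-choices : All Choice choices
    all-choices = All.tabulate λ {c} c∈ i →
      subst (lookup c i <_) (lookup∘tabulate classSize i) (∈-boundedVectors⁻ sizes c∈ i)

cyclic-lower-bound : ∀ r k t n .{{_ : NonZero k}} → 3 ≤ r → r ∸ 1 ≤ k → r < t →
                     ¬ (r ≡ 3 × t ≡ 4 × k ≡ 2) →
                     mGe r t n k ((n / k) ^ (k ∸ n % k) * ⌈ n / k ⌉ ^ (n % k))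
cyclic-lower-bound r k t n 3≤r r∸1≤k r<t non-exceptional =
  cyclic , cyclic-uniform , cyclic-K-free 3≤r t r<t non-exceptional ,
  subst (AtLeastMIS cyclic k) count≡ cyclic-MIS-count
  where
  2≤k : 2 ≤ k
  2≤k = ≤-trans (∸-monoˡ-≤ 1 3≤r) r∸1≤k
  r≤1+k : r ≤ suc k
  r≤1+k = ≤-trans (m≤n+m∸n r 1) (s≤s r∸1≤k)
  open Transversals k 2≤k n r 3≤r r≤1+k
  count≡ : suc q ^ s * q ^ (k ∸ s) ≡ q ^ (k ∸ s) * ⌈ n / k ⌉ ^ s
  count≡ = trans (*-comm (suc q ^ s) _) (cong (q ^ (k ∸ s) *_) (sym (⌈n/k⌉^[n%k]≡[1+n/k]^[n%k] n k)))

proposition6p1 : ((n : ℕ) → n ≥ 4 → mEq 3 4 n 2 (n ∸ 1))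
    × ((r k t n : ℕ) .{{_ : NonZero k}} → r ≥ 3 → k ≥ r ∸ 1 → t ≥ suc r
    → ¬ (r ≡ 3 × t ≡ 4 × k ≡ 2)
    → (s : ℕ) → s < k → n % k ≡ s
    → mGe r t n k ((n / k) ^ (k ∸ s) * ⌈ n / k ⌉ ^ s))
proposition6p1 = m₄³[n,2]≡n∸1 , λ where
  r k t n 3≤r r∸1≤k r<t non-exceptional _ _ refl →
    cyclic-lower-bound r k t n 3≤r r∸1≤k r<t non-exceptional
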